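{- Let $G$ be a graph with vertex set $V$ and adjacency matrix $A$, let $W\subseteq V$ be reducible in $G$, and let $v,w\in V\setminus W$ (possibly $v=w$). Then $v$ and $w$ are adjacent in $\Gamma_W(G)$ (for $v=w$: $v$ has a loop in $\Gamma_W(G)$) if and only if $$\mathrm{rank}_G(W\cup\{v\},\,W\cup\{w\})>\mathrm{rank}_G(W).$$ If moreover $W$ is nonsingular, this is equivalent to $\det(A_{W\cup\{v\},W\cup\{w\}})\neq 0$.
   Context: A graph is a finite graph with vertex set $V$, no multiple edges, in which each vertex may or may not carry a loop. Its adjacency matrix $A$ is the symmetric $V\times V$ matrix over $\mathbf{F}_2$ with $A_{vw}=1$ iff $v\ne w$ are adjacent and $A_{vv}=1$ iff $v$ has a loop. $A_{U_1,U_2}$ is the submatrix with rows $U_1$, columns $U_2$; $\mathrm{rank}_G(U_1,U_2)$ is its $\mathbf{F}_2$-rank and $\mathrm{rank}_G(U)=\mathrm{rank}_G(U,U)$. $W$ is nonsingular if $\mathrm{rank}_G(W)=|W|$. Let $\mathcal{V}$ be the $\mathbf{F}_2$-vector space with basis $V$, $\mathcal{E}(x,y)=x^TAy$, $\langle W\rangle$ the span of $W$, $\langle W\rangle^{\perp}=\{x:\mathcal{E}(x,u)=0\ \forall u\in\langle W\rangle\}$. $W$ is reducible in $G$ if $\langle W\rangle+\langle W\rangle^{\perp}=\mathcal{V}$. For reducible $W$, $\Gamma_W(G)$ is the graph on $V\setminus W$ in which $v,w\in V\setminus W$ are adjacent (a loop if $v=w$) iff $\mathcal{E}(v',w')=1$,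 where $v',w'\in\langle W\rangle^{\perp}$ are any vectors with $v-v',w-w'\in\langle W\rangle$ (independent of the choice). -}

module Defs where

open import Data.Bool using (Bool; true; false; _∧_; _xor_; if_then_else_)
open import Data.Nat using (ℕ; zero; suc; _<_; _≤_)
open import Data.Fin using (Fin; zero; suc; _≟_)
open import Data.Fin.Subset using (Subset; _∈_; _∉_; _⊆_; ∣_∣)
open import Data.List using (List; []; _∷_; map)
open import Data.Vec using (_∷_; lookup)
open import Data.Product using (Σ; _×_; ∃; ∃-syntax)
open import Relation.Nullary.Decidable using (⌊_⌋)
open import Relation.Binary.PropositionalEquality using (_≡_)

-- Graphs on vertex set V = Fin n, possibly with loops, given by their
-- symmetric adjacency matrix over F₂ = Bool (xor = +, ∧ = ·).

record Graph (n : ℕ) : Set where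
  field
    adj : Fin n → Fin n → Bool
    sym : ∀ v w → adj v w ≡ adj w v
open Graph public

Vect : ℕ → Set
Vect n = Fin n → Bool

sumF : ∀ {n} → (Fin n → Bool) → Bool
sumF {zero}  f = false
sumF {suc n} f = f zero xor sumF (λ i → f (suc i))

e : ∀ {n} → Fin n → Vect n
e v i = ⌊ i ≟ v ⌋

_+ᵥ_ : ∀ {n} → Vect n → Vect n → Vect n
(x +ᵥ y) i = x i xor y i

ℰ : ∀ {n} → Graph n → Vect n → Vect n → Bool
ℰ G x y = sumF (λ i → sumF (λ j → x i ∧ (adj G i j ∧ y j)))

InSpan : ∀ {n} → Subset n → Vect n → Set
InSpan {n} W x =
  Σ (Fin n → Bool) λ c →
    (∀ u → u ∉ W → c u ≡ false) × (∀ i → x i ≡ sumF (λ u → c u ∧ e u i))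

InPerp : ∀ {n} → Graph n → Subset n → Vect n → Set
InPerp G W x = ∀ u → InSpan W u → ℰ G x u ≡ false

Reducible : ∀ {n} → Graph n → Subset n → Set
Reducible {n} G W =
  (x : Vect n) → ∃[ a ] ∃[ b ] InSpan W a × InPerp G W b × (∀ i → x i ≡ (a +ᵥ b) i)

-- Adjacency (loop when v = w) in Γ_W(G), for v w ∉ W:
-- ℰ(v',w') = 1 for v', w' ∈ ⟨W⟩^⊥ with v - v', w - w' ∈ ⟨W⟩
-- (in F₂, subtraction is +ᵥ).
ΓAdj : ∀ {n} → Graph n → Subset n → Fin n → Fin n → Set
ΓAdj G W v w =
  ∃[ v' ] ∃[ w' ] InPerp G W v' × InPerp G W w'
    × InSpan W (e v +ᵥ v') × InSpan W (e w +ᵥ w') × ℰ G v' w' ≡ true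

RowsIndep : ∀ {n} → Graph n → Subset n → Subset n → Set
RowsIndep {n} G S U₂ =
  (c : Fin n → Bool) → (∀ i → i ∉ S → c i ≡ false) →
  (∀ j → j ∈ U₂ → sumF (λ i → c i ∧ adj G i j) ≡ false) →
  ∀ i → c i ≡ false

HasRank : ∀ {n} → Graph n → Subset n → Subset n → ℕ → Set
HasRank {n} G U₁ U₂ r =
  (Σ (Subset n) λ S → S ⊆ U₁ × RowsIndep G S U₂ × ∣ S ∣ ≡ r)
  × (∀ (S : Subset n) → S ⊆ U₁ → RowsIndep G S U₂ → ∣ S ∣ ≤ r)

RankGreater : ∀ {n} → Graph n → Subset n → Subset n → Subset n → Subset n → Set
RankGreater G U₁ U₂ U₃ U₄ =
  ∃[ r₁ ] ∃[ r₂ ] HasRank G U₁ U₂ r₁ × HasRank G U₃ U₄ r₂ × r₂ < r₁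

Nonsingular : ∀ {n} → Graph n → Subset n → Set
Nonsingular G W = HasRank G W W ∣ W ∣

-- Determinant over F₂ (signs are irrelevant in characteristic 2) of the
-- submatrix with rows / columns listed by two lists, by Laplace expansion
-- along the first row.

elems : ∀ {n} → Subset n → List (Fin n)
elems {zero}  _       = []
elems {suc n} (b ∷ p) =
  if b then zero ∷ map suc (elems p) else map suc (elems p)

-- expansion of row r with remaining rows rs; `pre` are the columns already
-- passed over, the columns still to be considered are the list argument.
mutual
  detL : ∀ {n} → Graph n → List (Fin n) → List (Fin n) → Bool
  detL G []       []       = true
  detL G []       (_ ∷ _)  = false
  detL G (r ∷ rs) cs       = expand G r rs [] cs

  expand : ∀ {n} → Graph n → Fin n → List (Fin n) →
           List (Fin n) → List (Fin n) → Bool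
  expand G r rs pre []       = false
  expand G r rs pre (c ∷ cs) =
    (adj G r c ∧ detL G rs (revApp pre cs)) xor expand G r rs (c ∷ pre) cs

  revApp : ∀ {A : Set} → List A → List A → List A
  revApp []       ys = ys
  revApp (x ∷ xs) ys = revApp xs (x ∷ ys)

det : ∀ {n} → Graph n → Subset n → Subset n → Bool
det G U₁ U₂ = detL G (elems U₁) (elems U₂)

module Submission where

-- Reducibility gives representatives v', w' ∈ ⟨W⟩^⊥ of v, w (v − v' and
-- w − w' in ⟨W⟩), and v ~ w in Γ_W(G) means ε = ℰ(v',w') = 1.  Everything
-- rests on two facts: for x ⊥ W the column w of xA equals ℰ(x,w'), and a
-- radical vector x ∈ ⟨W⟩ ∩ ⟨W⟩^⊥ has (xA)_w = 0.  From them: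
--   key lemma A: if ε = 1, rows S ⊆ W independent on the columns W stay
--     independent after adjoining the row v and the column w;
--   key lemma B: if ε = 0 and T ⊆ W spans the rows W, no family containing
--     T and v is independent on the columns W ∪ {w}.
-- With S a basis of W, and T a maximum independent subset of W (which spans
-- W), this is the rank criterion.  For nonsingular W take S = T = W: then
-- v ~ w iff the rows W ∪ {v} are independent on W ∪ {w}, and the general
-- fact that a square F₂-determinant is 1 iff its rows are independent
-- (Laplace expansion is multilinear and alternating, so Det survives
-- Gaussian elimination) turns this into det ≠ 0.

open import Defs renaming (sym to adj-sym)

open import Algebra using (CommutativeRing)
open import Data.Bool using (Bool; true; false; not; _∧_; _xor_)
open import Data.Bool.Properties
  using (∧-assoc; ∧-comm; ∧-zeroʳ; ∧-identityʳ; ∧-distribˡ-xor; ∧-distribʳ-xor;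
         xor-assoc; xor-comm; xor-identityʳ; xor-same; xor-∧-commutativeRing)
import Data.Bool.Properties as Bool
open import Data.Fin using (Fin; zero; suc; _≟_)
open import Data.Fin.Properties using (all?; any?)
import Data.Fin.Properties as Fin
open import Data.Fin.Subset using (Subset; _∈_; _∉_; _⊆_; _∪_; ⁅_⁆; _-_; ∣_∣; ⊥; inside; outside)
open import Data.Fin.Subset.Properties
  using (_∈?_; _⊆?_; ⊆-refl; x∈p∪q⁻; x∈p∪q⁺; x∈⁅x⁆; x∈⁅y⁆⇒x≡y; p─q⊆p; p─⊥≡p; ∪-identityʳ;
         p⊂q⇒∣p∣<∣q∣; ∣p∣≤n; ∉⊥; ∣⊥∣≡0; anySubset?)
open import Data.List using (List; []; _∷_; length)
open import Data.List.Properties using (length-map)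
open import Data.List.Membership.Propositional using (find) renaming (_∈_ to _∈ˡ_; _∉_ to _∉ˡ_)
open import Data.List.Membership.Propositional.Properties using (∈-map⁺; ∈-map⁻)
import Data.List.Relation.Unary.Any as Any
import Data.List.Relation.Unary.All as All
open import Data.List.Relation.Unary.All.Properties using (¬Any⇒All¬; All¬⇒¬Any)
import Data.List.Relation.Unary.All.Properties as AllP
open import Data.List.Relation.Unary.Unique.Propositional using (Unique; []; _∷_)
open import Data.List.Relation.Unary.Unique.Propositional.Properties using (map⁺)
open import Data.Nat using (ℕ; zero; suc; _≤_; _<_; z≤n; s≤s; s≤s⁻¹)
import Data.Nat as ℕ
open import Data.Nat.Properties
  using (≤-reflexive; <-irrefl; ≤∧≢⇒<; <⇒≱; m≤n⇒m≤1+n; suc-injective; module ≤-Reasoning)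
open import Data.Product using (Σ; ∃; _,_; _×_; proj₁; proj₂)
open import Data.Sum using (_⊎_; inj₁; inj₂; [_,_])
import Data.Sum as Sum
open import Data.Vec using ([]; _∷_; here; there; lookup; tabulate)
open import Data.Vec.Properties using (lookup∘tabulate)
open import Function using (_∘_)
open import Function.Bundles using (_⇔_; mk⇔; Equivalence)
open import Function.Construct.Composition using (_⇔-∘_)
open import Function.Construct.Identity using (⇔-id)
open import Function.Construct.Symmetry using (⇔-sym)
open import Relation.Binary.PropositionalEquality hiding ([_])
open import Relation.Nullary using (¬_; Dec; yes; no; contradiction; ¬?)
open import Relation.Nullary.Decidable using (map′; _×-dec_; _→-dec_)

open import Algebra.Properties.CommutativeSemigroup
  (CommutativeRing.+-commutativeSemigroup xor-∧-commutativeRing)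
  using () renaming (interchange to xor-interchange; xy∙z≈xz∙y to xor-swapʳ)

xor-cancelʳ : ∀ a b → (a xor b) xor b ≡ a
xor-cancelʳ a b = trans (xor-assoc a b b) (trans (cong (a xor_) (xor-same b)) (xor-identityʳ a))

xor-telescope : ∀ a b c → (a xor b) xor (b xor c) ≡ a xor c
xor-telescope a b c =
  trans (xor-assoc a b (b xor c))
        (cong (a xor_) (trans (sym (xor-assoc b b c)) (cong (_xor c) (xor-same b))))

xor-∧-zeroʳ : ∀ x b {t} → t ≡ false → x xor (b ∧ t) ≡ x
xor-∧-zeroʳ x b refl = trans (cong (x xor_) (∧-zeroʳ b)) (xor-identityʳ x)

xor-∧-zeroˡ : ∀ x {b} t → b ≡ false → x xor (b ∧ t) ≡ x
xor-∧-zeroˡ x t refl = xor-identityʳ x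

sumF-cong : ∀ {n} {f g : Fin n → Bool} → (∀ i → f i ≡ g i) → sumF f ≡ sumF g
sumF-cong {zero}  f≗g = refl
sumF-cong {suc n} f≗g = cong₂ _xor_ (f≗g zero) (sumF-cong (f≗g ∘ suc))

sumF-xor : ∀ {n} (f g : Fin n → Bool) → sumF (λ i → f i xor g i) ≡ sumF f xor sumF g
sumF-xor {zero}  f g = refl
sumF-xor {suc n} f g =
  trans (cong ((f zero xor g zero) xor_) (sumF-xor (f ∘ suc) (g ∘ suc)))
        (xor-interchange (f zero) (g zero) _ _)

sumF-∧ˡ : ∀ {n} b (f : Fin n → Bool) → sumF (λ i → b ∧ f i) ≡ b ∧ sumF f
sumF-∧ˡ {zero}  b f = sym (∧-zeroʳ b)
sumF-∧ˡ {suc n} b f = trans (cong ((b ∧ f zero) xor_) (sumF-∧ˡ b (f ∘ suc)))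
                            (sym (∧-distribˡ-xor b (f zero) _))

sumF-∧ʳ : ∀ {n} b (f : Fin n → Bool) → sumF (λ i → f i ∧ b) ≡ sumF f ∧ b
sumF-∧ʳ {zero}  b f = refl
sumF-∧ʳ {suc n} b f = trans (cong ((f zero ∧ b) xor_) (sumF-∧ʳ b (f ∘ suc)))
                            (sym (∧-distribʳ-xor b (f zero) _))

sumF-zero : ∀ {n} (f : Fin n → Bool) → (∀ i → f i ≡ false) → sumF f ≡ false
sumF-zero {zero}  f f≗0 = refl
sumF-zero {suc n} f f≗0 = cong₂ _xor_ (f≗0 zero) (sumF-zero (f ∘ suc) (f≗0 ∘ suc))

sumF-swap : ∀ {m n} (f : Fin m → Fin n → Bool) →
  sumF (λ i → sumF (λ j → f i j)) ≡ sumF (λ j → sumF (λ i → f i j))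
sumF-swap {zero}  {n} f = sym (sumF-zero {n} (λ _ → false) (λ _ → refl))
sumF-swap {suc m} f =
  trans (cong (sumF (f zero) xor_) (sumF-swap (f ∘ suc)))
        (sym (sumF-xor (f zero) (λ j → sumF (λ i → f (suc i) j))))

e-self : ∀ {n} (v : Fin n) → e v v ≡ true
e-self v with v ≟ v
... | yes _   = refl
... | no v≢v = contradiction refl v≢v

e-other : ∀ {n} (v i : Fin n) → i ≢ v → e v i ≡ false
e-other v i i≢v with i ≟ v
... | yes i≡v = contradiction i≡v i≢v
... | no _    = refl

e-sym : ∀ {n} (u i : Fin n) → e u i ≡ e i u
e-sym u i with i ≟ u
... | yes refl = sym (e-self i)
... | no i≢u   = sym (e-other i u (i≢u ∘ sym))

sumF-e : ∀ {n} (c : Fin n → Bool) (i : Fin n) → sumF (λ u → c u ∧ e i u) ≡ c i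
sumF-e {suc n} c zero =
  trans (cong₂ _xor_ (∧-identityʳ (c zero))
                     (sumF-zero _ (λ u → ∧-zeroʳ (c (suc u)))))
        (xor-identityʳ (c zero))
sumF-e {suc n} c (suc i) =
  trans (cong (_xor sumF (λ u → c (suc u) ∧ e (suc i) (suc u))) (∧-zeroʳ (c zero)))
        (trans (sumF-cong (λ u → cong (c (suc u) ∧_) (suc-e u)))
               (sumF-e (c ∘ suc) i))
  where
  suc-e : ∀ u → e (suc i) (suc u) ≡ e i u
  suc-e u with u ≟ i
  ... | yes _ = refl
  ... | no _  = refl

sumF-basis : ∀ {n} (x : Vect n) (i : Fin n) → sumF (λ u → x u ∧ e u i) ≡ x i
sumF-basis x i = trans (sumF-cong (λ u → cong (x u ∧_) (e-sym u i))) (sumF-e x i)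

Mat : ℕ → Set
Mat n = Fin n → Fin n → Bool

lincomb : ∀ {n} → Mat n → Vect n → Vect n
lincomb M x j = sumF (λ i → x i ∧ M i j)

lincomb-cong : ∀ {n} (M : Mat n) {x y : Vect n} → (∀ i → x i ≡ y i) →
  ∀ j → lincomb M x j ≡ lincomb M y j
lincomb-cong M x≗y j = sumF-cong (λ i → cong (_∧ M i j) (x≗y i))

lincomb-xor : ∀ {n} (M : Mat n) (x y : Vect n) j →
  lincomb M (x +ᵥ y) j ≡ lincomb M x j xor lincomb M y j
lincomb-xor M x y j = trans (sumF-cong (λ i → ∧-distribʳ-xor (M i j) (x i) (y i)))
                            (sumF-xor (λ i → x i ∧ M i j) (λ i → y i ∧ M i j))

lincomb-zero : ∀ {n} (M : Mat n) {x : Vect n} → (∀ i → x i ≡ false) →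
  ∀ j → lincomb M x j ≡ false
lincomb-zero M x≗0 j = sumF-zero _ (λ i → cong (_∧ M i j) (x≗0 i))

ℰ-lincomb : ∀ {n} (G : Graph n) x y → ℰ G x y ≡ sumF (λ j → lincomb (adj G) x j ∧ y j)
ℰ-lincomb G x y = trans (sumF-swap (λ i j → x i ∧ (adj G i j ∧ y j)))
  (sumF-cong (λ j → trans (sumF-cong (λ i → sym (∧-assoc (x i) (adj G i j) (y j))))
                          (sumF-∧ʳ (y j) (λ i → x i ∧ adj G i j))))

ℰ-basisʳ : ∀ {n} (G : Graph n) x j → ℰ G x (e j) ≡ lincomb (adj G) x j
ℰ-basisʳ G x j = trans (ℰ-lincomb G x (e j)) (sumF-e (lincomb (adj G) x) j)

ℰ-xorʳ : ∀ {n} (G : Graph n) x (y z : Vect n) → ℰ G x (y +ᵥ z) ≡ ℰ G x y xor ℰ G x z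
ℰ-xorʳ G x y z = begin
  ℰ G x (y +ᵥ z)
    ≡⟨ ℰ-lincomb G x (y +ᵥ z) ⟩
  sumF (λ j → L j ∧ (y j xor z j))
    ≡⟨ sumF-cong (λ j → ∧-distribˡ-xor (L j) (y j) (z j)) ⟩
  sumF (λ j → (L j ∧ y j) xor (L j ∧ z j))
    ≡⟨ sumF-xor (λ j → L j ∧ y j) (λ j → L j ∧ z j) ⟩
  sumF (λ j → L j ∧ y j) xor sumF (λ j → L j ∧ z j)
    ≡⟨ sym (cong₂ _xor_ (ℰ-lincomb G x y) (ℰ-lincomb G x z)) ⟩
  ℰ G x y xor ℰ G x z ∎
  where
  open ≡-Reasoning
  L = lincomb (adj G) x

ℰ-congʳ : ∀ {n} (G : Graph n) x {y z : Vect n} → (∀ i → y i ≡ z i) → ℰ G x y ≡ ℰ G x z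
ℰ-congʳ G x y≗z = sumF-cong (λ i → sumF-cong (λ j → cong (λ b → x i ∧ (adj G i j ∧ b)) (y≗z j)))

ℰ-sym : ∀ {n} (G : Graph n) x y → ℰ G x y ≡ ℰ G y x
ℰ-sym G x y = trans (sumF-swap (λ i j → x i ∧ (adj G i j ∧ y j)))
  (sumF-cong (λ j → sumF-cong (λ i → rotate (x i) (y j) (adj-sym G i j))))
  where
  rotate : ∀ a b {c d} → c ≡ d → a ∧ (c ∧ b) ≡ b ∧ (d ∧ a)
  rotate a b {c} refl = trans (∧-comm a (c ∧ b)) (trans (∧-assoc c b a)
    (trans (cong (c ∧_) (∧-comm b a)) (trans (sym (∧-assoc c a b)) (∧-comm (c ∧ a) b))))

SupportedIn : ∀ {n} → (Fin n → Set) → Vect n → Set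
SupportedIn P x = ∀ i → ¬ P i → x i ≡ false

VanishesOn : ∀ {n} → Mat n → (Fin n → Set) → Vect n → Set
VanishesOn M Q x = ∀ j → Q j → lincomb M x j ≡ false

-- The rows P of M are linearly independent when restricted to the columns Q.
-- RowsIndep G S U is, by definition, Independent (adj G) (_∈ S) (_∈ U).
Independent : ∀ {n} → Mat n → (Fin n → Set) → (Fin n → Set) → Set
Independent M P Q = ∀ c → SupportedIn P c → VanishesOn M Q c → ∀ i → c i ≡ false

span⇒supported : ∀ {n} {W : Subset n} {x} → InSpan W x → SupportedIn (_∈ W) x
span⇒supported {x = x} (c , c∉W , x≗Σ) i i∉W =
  trans (x≗Σ i) (trans (sumF-basis c i) (c∉W i i∉W))

supported⇒span : ∀ {n} {W : Subset n} {x} → SupportedIn (_∈ W) x → InSpan W x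
supported⇒span {x = x} x∉W = x , x∉W , (λ i → sym (sumF-basis x i))

e-supported : ∀ {n} {W : Subset n} {u} → u ∈ W → SupportedIn (_∈ W) (e u)
e-supported {u = u} u∈W i i∉W = e-other u i (λ { refl → i∉W u∈W })

perp⇒vanishes : ∀ {n} (G : Graph n) {W : Subset n} {x} →
  InPerp G W x → VanishesOn (adj G) (_∈ W) x
perp⇒vanishes G {x = x} x⊥ j j∈W =
  trans (sym (ℰ-basisʳ G x j)) (x⊥ (e j) (supported⇒span (e-supported j∈W)))

vanishes⇒ℰ≡0 : ∀ {n} (G : Graph n) {W : Subset n} {x y} →
  VanishesOn (adj G) (_∈ W) x → SupportedIn (_∈ W) y → ℰ G x y ≡ false
vanishes⇒ℰ≡0 G {W} {x} {y} xA≡0 y∉W =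
  trans (ℰ-lincomb G x y) (sumF-zero _ term≡0)
  where
  term≡0 : ∀ j → lincomb (adj G) x j ∧ y j ≡ false
  term≡0 j with j ∈? W
  ... | yes j∈W = cong (_∧ y j) (xA≡0 j j∈W)
  ... | no j∉W  = trans (cong (lincomb (adj G) x j ∧_) (y∉W j j∉W)) (∧-zeroʳ _)

ℰ-coset : ∀ {n} (G : Graph n) {W : Subset n} {x y y'} →
  VanishesOn (adj G) (_∈ W) x → InSpan W (y +ᵥ y') → ℰ G x y ≡ ℰ G x y'
ℰ-coset G {W} {x} {y} {y'} x⊥W y-y'∈⟨W⟩ = begin
  ℰ G x y
    ≡⟨ ℰ-congʳ G x (λ i → sym (xor-cancelʳ (y i) (y' i))) ⟩
  ℰ G x ((y +ᵥ y') +ᵥ y')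
    ≡⟨ ℰ-xorʳ G x (y +ᵥ y') y' ⟩
  ℰ G x (y +ᵥ y') xor ℰ G x y'
    ≡⟨ cong (_xor ℰ G x y') (vanishes⇒ℰ≡0 G x⊥W (span⇒supported y-y'∈⟨W⟩)) ⟩
  ℰ G x y' ∎
  where open ≡-Reasoning

supported-xor : ∀ {n} {P : Fin n → Set} {x y} →
  SupportedIn P x → SupportedIn P y → SupportedIn P (x +ᵥ y)
supported-xor x∉P y∉P i i∉P = cong₂ _xor_ (x∉P i i∉P) (y∉P i i∉P)

supported-mono : ∀ {n} {P Q : Fin n → Set} → (∀ {i} → P i → Q i) →
  ∀ {x} → SupportedIn P x → SupportedIn Q x
supported-mono P⊆Q x∉P i i∉Q = x∉P i (i∉Q ∘ P⊆Q)

∈-∪⁅⁆⁻ : ∀ {n} (S : Subset n) v {i} → i ∈ S ∪ ⁅ v ⁆ → i ∈ S ⊎ i ≡ v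
∈-∪⁅⁆⁻ S v i∈ = Sum.map₂ (x∈⁅y⁆⇒x≡y v) (x∈p∪q⁻ S ⁅ v ⁆ i∈)

∈-∪⁅⁆ˡ : ∀ {n} {S : Subset n} v {i} → i ∈ S → i ∈ S ∪ ⁅ v ⁆
∈-∪⁅⁆ˡ v i∈S = x∈p∪q⁺ (inj₁ i∈S)

∈-∪⁅⁆ʳ : ∀ {n} (S : Subset n) v → v ∈ S ∪ ⁅ v ⁆
∈-∪⁅⁆ʳ S v = x∈p∪q⁺ {p = S} (inj₂ (x∈⁅x⁆ v))

supported-drop : ∀ {n} (S : Subset n) v {c : Vect n} →
  SupportedIn (_∈ S ∪ ⁅ v ⁆) c → c v ≡ false → SupportedIn (_∈ S) c
supported-drop S v c∉ cv≡0 i i∉S with i ≟ v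
... | yes refl = cv≡0
... | no i≢v   = c∉ i ([ i∉S , i≢v ] ∘ ∈-∪⁅⁆⁻ S v)

supported-remove : ∀ {n} (S : Subset n) v {c : Vect n} →
  SupportedIn (_∈ S ∪ ⁅ v ⁆) c → c v ≡ true → SupportedIn (_∈ S) (c +ᵥ e v)
supported-remove S v c∉ cv≡1 i i∉S with i ≟ v
... | yes refl = cong (_xor true) cv≡1
... | no i≢v   = cong₂ _xor_ (c∉ i ([ i∉S , i≢v ] ∘ ∈-∪⁅⁆⁻ S v)) refl

supported-cong : ∀ {n} {P : Fin n → Set} {x y : Vect n} →
  (∀ i → x i ≡ y i) → SupportedIn P x → SupportedIn P y
supported-cong x≗y x∉P i i∉P = trans (sym (x≗y i)) (x∉P i i∉P)

vanishes-cong : ∀ {n} (M : Mat n) {Q : Fin n → Set} {x y : Vect n} →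
  (∀ i → x i ≡ y i) → VanishesOn M Q x → VanishesOn M Q y
vanishes-cong M x≗y xM≡0 j j∈Q = trans (sym (lincomb-cong M x≗y j)) (xM≡0 j j∈Q)

vanishes-xor : ∀ {n} (M : Mat n) {Q : Fin n → Set} {x y : Vect n} →
  VanishesOn M Q x → VanishesOn M Q y → VanishesOn M Q (x +ᵥ y)
vanishes-xor M {x = x} {y} xM≡0 yM≡0 j j∈Q =
  trans (lincomb-xor M x y j) (cong₂ _xor_ (xM≡0 j j∈Q) (yM≡0 j j∈Q))

Represents : ∀ {n} → Graph n → Subset n → Fin n → Vect n → Set
Represents G W v v' = InPerp G W v' × InSpan W (e v +ᵥ v')

-- Reducibility provides representatives: if e_v = a + b with a ∈ ⟨W⟩ and
-- b ∈ ⟨W⟩^⊥, then b represents v.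
representative : ∀ {n} (G : Graph n) (W : Subset n) → Reducible G W →
  ∀ v → Σ (Vect n) (Represents G W v)
representative G W red v with red (e v)
... | a , b , a∈⟨W⟩ , b⊥ , ev≗a+b =
  b , b⊥ , supported⇒span (supported-cong v-b≗a (span⇒supported a∈⟨W⟩))
  where
  v-b≗a : ∀ i → a i ≡ e v i xor b i
  v-b≗a i = sym (trans (cong (_xor b i) (ev≗a+b i)) (xor-cancelʳ (a i) (b i)))

column-via-representative : ∀ {n} (G : Graph n) {W : Subset n} {w w' x} →
  Represents G W w w' → VanishesOn (adj G) (_∈ W) x → lincomb (adj G) x w ≡ ℰ G x w'
column-via-representative G {x = x} (_ , w-w') x⊥W =
  trans (sym (ℰ-basisʳ G x _)) (ℰ-coset G x⊥W w-w')

radical-column : ∀ {n} (G : Graph n) {W : Subset n} {w w' x} →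
  Represents G W w w' → SupportedIn (_∈ W) x → VanishesOn (adj G) (_∈ W) x →
  lincomb (adj G) x w ≡ false
radical-column G {x = x} w-rep@(w'⊥ , _) x∈⟨W⟩ x⊥W =
  trans (column-via-representative G w-rep x⊥W)
        (trans (ℰ-sym G x _) (w'⊥ x (supported⇒span x∈⟨W⟩)))

-- Row spans: modulo combinations vanishing on the columns W, the row
-- combination xM is a combination of the rows T.
InRowSpan : ∀ {n} → Mat n → Subset n → Subset n → Vect n → Set
InRowSpan {n} M T W x = Σ (Vect n) λ d → SupportedIn (_∈ T) d × VanishesOn M (_∈ W) (x +ᵥ d)

row-span-basis : ∀ {n} (M : Mat n) {T W : Subset n} {u} → u ∈ T → InRowSpan M T W (e u)
row-span-basis M {u = u} u∈T = e u , e-supported u∈T , λ j _ → lincomb-zero M (λ i → xor-same (e u i)) j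

Spans : ∀ {n} → Mat n → Subset n → Subset n → Set
Spans M T W = ∀ u → u ∈ W → InRowSpan M T W (e u)

module _ {n} (M : Mat n) (T W : Subset n) where

  row-span-zero : InRowSpan M T W (λ _ → false)
  row-span-zero = (λ _ → false) , (λ _ _ → refl) , (λ j _ → lincomb-zero M (λ _ → refl) j)

  row-span-xor : ∀ {x y} → InRowSpan M T W x → InRowSpan M T W y → InRowSpan M T W (x +ᵥ y)
  row-span-xor {x} {y} (d₁ , d₁∈T , x+d₁⊥) (d₂ , d₂∈T , y+d₂⊥) =
    (d₁ +ᵥ d₂) , supported-xor d₁∈T d₂∈T ,
    vanishes-cong M (λ i → xor-interchange (x i) (d₁ i) (y i) (d₂ i)) (vanishes-xor M x+d₁⊥ y+d₂⊥)

  row-span-sum : ∀ {m} (f : Fin m → Vect n) → (∀ u → InRowSpan M T W (f u)) →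
    InRowSpan M T W (λ i → sumF (λ u → f u i))
  row-span-sum {zero}  f f∈ = row-span-zero
  row-span-sum {suc m} f f∈ = row-span-xor {f zero} (f∈ zero) (row-span-sum (f ∘ suc) (f∈ ∘ suc))

  -- If T spans W, every vector of ⟨W⟩ lies in the row span of T: expand it
  -- in the standard basis.
  spans⇒row-span : Spans M T W → ∀ {x} → SupportedIn (_∈ W) x → InRowSpan M T W x
  spans⇒row-span T-spans {x} x∈⟨W⟩ =
    let d , d∈T , ⊥W = row-span-sum (λ u i → x u ∧ e u i) term in
    d , d∈T , vanishes-cong M (λ i → cong (_xor d i) (sumF-basis x i)) ⊥W
    where
    term : ∀ u → InRowSpan M T W (λ i → x u ∧ e u i)
    term u with x u in xu | u ∈? W
    ... | false | _      = row-span-zero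
    ... | true  | yes u∈W = T-spans u u∈W
    ... | true  | no u∉W  = contradiction (trans (sym xu) (x∈⟨W⟩ u u∉W)) λ ()

-- If ℰ(v',w') = 1, adjoining the row v and the column w to an
-- independent family S ⊆ W keeps it independent: a dependency c using row v
-- would make x = c + v' a radical vector, whose column w is 0, while the
-- column w of cA = xA + v'A would then be ℰ(v',w') = 1.
extend-independent : ∀ {n} (G : Graph n) {W S : Subset n} {v w v' w'} →
  Represents G W v v' → Represents G W w w' → ℰ G v' w' ≡ true →
  S ⊆ W → Independent (adj G) (_∈ S) (_∈ W) →
  Independent (adj G) (_∈ S ∪ ⁅ v ⁆) (_∈ W ∪ ⁅ w ⁆)
extend-independent G {W} {S} {v} {w} {v'} (v'⊥ , v-v') w-rep ε≡1 S⊆W S-indep c c∉ cA≡0 i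
  with c v in cv
... | false = S-indep c (supported-drop S v c∉ cv) (λ j j∈W → cA≡0 j (∈-∪⁅⁆ˡ w j∈W)) i
... | true  = contradiction (trans (sym cw≡1) (cA≡0 w (∈-∪⁅⁆ʳ W w))) λ ()
  where
  A = adj G
  x = c +ᵥ v'
  x∈⟨W⟩ : SupportedIn (_∈ W) x
  x∈⟨W⟩ = supported-cong (λ i → xor-telescope (c i) (e v i) (v' i))
            (supported-xor (supported-mono S⊆W (supported-remove S v c∉ cv)) (span⇒supported v-v'))
  x⊥W : VanishesOn A (_∈ W) x
  x⊥W = vanishes-xor A (λ j j∈W → cA≡0 j (∈-∪⁅⁆ˡ w j∈W)) (perp⇒vanishes G v'⊥)
  cw≡1 : lincomb A c w ≡ true
  cw≡1 = begin
    lincomb A c w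
      ≡⟨ lincomb-cong A (λ i → sym (xor-cancelʳ (c i) (v' i))) w ⟩
    lincomb A (x +ᵥ v') w
      ≡⟨ lincomb-xor A x v' w ⟩
    lincomb A x w xor lincomb A v' w
      ≡⟨ cong₂ _xor_ (radical-column G w-rep x∈⟨W⟩ x⊥W)
                     (column-via-representative G w-rep (perp⇒vanishes G v'⊥)) ⟩
    ℰ G v' _
      ≡⟨ ε≡1 ⟩
    true ∎
    where open ≡-Reasoning

-- If ℰ(v',w') = 0 and T ⊆ W spans the rows W, then no family
-- S ⊇ T ∪ {v} with v ∉ T is independent on the columns W ∪ {w}: writing
-- e_v + v' ∈ ⟨W⟩ modulo the kernel as a combination d of T, the vector
-- c = e_v + d is a dependency (its column w is ℰ(v',w') = 0).
dependency-through-v : ∀ {n} (G : Graph n) {W T S : Subset n} {v w v' w'} →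
  Represents G W v v' → Represents G W w w' → ℰ G v' w' ≡ false →
  T ⊆ W → Spans (adj G) T W → T ⊆ S → v ∈ S → v ∉ T →
  ¬ Independent (adj G) (_∈ S) (_∈ W ∪ ⁅ w ⁆)
dependency-through-v G {W} {T} {S} {v} {w} {v'} (v'⊥ , v-v') w-rep ε≡0 T⊆W T-spans T⊆S v∈S v∉T S-indep =
  contradiction (trans (sym cv≡1) (S-indep c c∈S cA≡0 v)) λ ()
  where
  A = adj G
  a = e v +ᵥ v'
  span-a : InRowSpan A T W a
  span-a = spans⇒row-span A T W T-spans (span⇒supported v-v')
  d : Vect _
  d = proj₁ span-a
  d∈T : SupportedIn (_∈ T) d
  d∈T = proj₁ (proj₂ span-a)
  y = a +ᵥ d
  y⊥W : VanishesOn A (_∈ W) y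
  y⊥W = proj₂ (proj₂ span-a)
  y∈⟨W⟩ : SupportedIn (_∈ W) y
  y∈⟨W⟩ = supported-xor (span⇒supported v-v') (supported-mono T⊆W d∈T)
  c = y +ᵥ v'
  c≗ : ∀ i → c i ≡ e v i xor d i
  c≗ i = trans (cong (_xor v' i) (xor-swapʳ (e v i) (v' i) (d i))) (xor-cancelʳ (e v i xor d i) (v' i))
  cv≡1 : c v ≡ true
  cv≡1 = trans (c≗ v) (cong₂ _xor_ (e-self v) (d∈T v v∉T))
  c∈S : SupportedIn (_∈ S) c
  c∈S = supported-cong (sym ∘ c≗)
          (supported-xor (e-supported v∈S) (supported-mono T⊆S d∈T))
  cA≡0 : VanishesOn A (_∈ W ∪ ⁅ w ⁆) c
  cA≡0 j j∈ with ∈-∪⁅⁆⁻ W w j∈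
  ... | inj₁ j∈W = vanishes-xor A y⊥W (perp⇒vanishes G v'⊥) j j∈W
  ... | inj₂ refl = trans (lincomb-xor A y v' j)
    (cong₂ _xor_ (radical-column G w-rep y∈⟨W⟩ y⊥W)
                 (trans (column-via-representative G w-rep (perp⇒vanishes G v'⊥)) ε≡0))

∣p∪⁅x⁆∣≡1+∣p∣ : ∀ {n} {p : Subset n} {x} → x ∉ p → ∣ p ∪ ⁅ x ⁆ ∣ ≡ suc ∣ p ∣
∣p∪⁅x⁆∣≡1+∣p∣ {p = outside ∷ p} {zero}  x∉p = cong (suc ∘ ∣_∣) (∪-identityʳ p)
∣p∪⁅x⁆∣≡1+∣p∣ {p = inside  ∷ p} {zero}  x∉p = contradiction here x∉p
∣p∪⁅x⁆∣≡1+∣p∣ {p = outside ∷ p} {suc x} x∉p = ∣p∪⁅x⁆∣≡1+∣p∣ (x∉p ∘ there)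
∣p∪⁅x⁆∣≡1+∣p∣ {p = inside  ∷ p} {suc x} x∉p = cong suc (∣p∪⁅x⁆∣≡1+∣p∣ (x∉p ∘ there))

∣p∣<∣p∪⁅x⁆∣ : ∀ {n} {p : Subset n} {x} → x ∉ p → ∣ p ∣ < ∣ p ∪ ⁅ x ⁆ ∣
∣p∣<∣p∪⁅x⁆∣ x∉p = ≤-reflexive (sym (∣p∪⁅x⁆∣≡1+∣p∣ x∉p))

∣p∣≡1+∣p-x∣ : ∀ {n} {p : Subset n} {x} → x ∈ p → ∣ p ∣ ≡ suc ∣ p - x ∣
∣p∣≡1+∣p-x∣ {p = inside  ∷ p} here        = cong suc (sym (cong ∣_∣ (p─⊥≡p p)))
∣p∣≡1+∣p-x∣ {p = outside ∷ p} (there x∈p) = ∣p∣≡1+∣p-x∣ x∈p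
∣p∣≡1+∣p-x∣ {p = inside  ∷ p} (there x∈p) = cong suc (∣p∣≡1+∣p-x∣ x∈p)

x∈p-y⇒x≢y : ∀ {n} {p : Subset n} {x y : Fin n} → x ∈ p - y → x ≢ y
x∈p-y⇒x≢y {p = _ ∷ p} {y = zero}  (there _)   ()
x∈p-y⇒x≢y {p = _ ∷ p} {y = suc y} here        ()
x∈p-y⇒x≢y {p = _ ∷ p} {y = suc y} (there x∈p) refl = x∈p-y⇒x≢y x∈p refl

⊆∧∣≡∣⇒⊇ : ∀ {n} {S W : Subset n} → S ⊆ W → ∣ S ∣ ≡ ∣ W ∣ → W ⊆ S
⊆∧∣≡∣⇒⊇ {S = S} S⊆W ∣S∣≡∣W∣ {x} x∈W with x ∈? S
... | yes x∈S = x∈S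
... | no x∉S  = contradiction (p⊂q⇒∣p∣<∣q∣ (S⊆W , x , x∈W , x∉S)) (<-irrefl ∣S∣≡∣W∣)

any-vector? : ∀ {n} {Q : Vect n → Set} → (∀ {x y} → (∀ i → x i ≡ y i) → Q x → Q y) →
  (∀ x → Dec (Q x)) → Dec (Σ (Vect n) Q)
any-vector? Q-resp Q? =
  map′ (λ (s , q) → lookup s , q)
       (λ (x , q) → tabulate x , Q-resp (λ i → sym (lookup∘tabulate x i)) q)
       (anySubset? (Q? ∘ lookup))

Dependency : ∀ {n} → Mat n → Subset n → Subset n → Vect n → Set
Dependency M S U c = SupportedIn (_∈ S) c × VanishesOn M (_∈ U) c × ∃ λ i → c i ≡ true

dependency-or-independent : ∀ {n} (M : Mat n) (S U : Subset n) →
  Σ (Vect n) (Dependency M S U) ⊎ Independent M (_∈ S) (_∈ U)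
dependency-or-independent M S U with any-vector? respects decide
  where
  respects : ∀ {x y} → (∀ i → x i ≡ y i) → Dependency M S U x → Dependency M S U y
  respects x≗y (x∈S , xM≡0 , i , xi) =
    supported-cong x≗y x∈S , vanishes-cong M x≗y xM≡0 , i , trans (sym (x≗y i)) xi
  decide : ∀ c → Dec (Dependency M S U c)
  decide c = all? (λ i → ¬? (i ∈? S) →-dec (c i Bool.≟ false))
       ×-dec all? (λ j → (j ∈? U) →-dec (lincomb M c j Bool.≟ false))
       ×-dec any? (λ i → c i Bool.≟ true)
... | yes dependency  = inj₁ dependency
... | no ¬dependency = inj₂ independent
  where
  independent : Independent M (_∈ S) (_∈ U)
  independent c c∈S cM≡0 i with c i in ci
  ... | false = refl
  ... | true  = contradiction (c , c∈S , cM≡0 , i , ci) ¬dependency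

-- Existence of the rank: a largest independent subfamily exists, found by
-- searching the sizes downwards from n.
rank-exists : ∀ {n} (G : Graph n) U₁ U₂ → Σ ℕ (HasRank G U₁ U₂)
rank-exists {n} G U₁ U₂ = search n (λ S _ _ → ∣p∣≤n S)
  where
  independent? : ∀ S → Dec (RowsIndep G S U₂)
  independent? S with dependency-or-independent (adj G) S U₂
  ... | inj₁ (c , c∈S , cA≡0 , i , ci) =
    no λ S-indep → contradiction (trans (sym ci) (S-indep c c∈S cA≡0 i)) λ ()
  ... | inj₂ S-indep = yes S-indep
  search : ∀ b → (∀ S → S ⊆ U₁ → RowsIndep G S U₂ → ∣ S ∣ ≤ b) → Σ ℕ (HasRank G U₁ U₂)
  search b ≤b with anySubset? (λ S → (S ⊆? U₁) ×-dec independent? S ×-dec (∣ S ∣ ℕ.≟ b))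
  ... | yes witness = b , witness , ≤b
  search zero    ≤b | no ¬witness =
    contradiction (⊥ , (λ {_} x∈⊥ → contradiction x∈⊥ ∉⊥) , (λ c c∈⊥ _ i → c∈⊥ i ∉⊥) , ∣⊥∣≡0 n) ¬witness
  search (suc b) ≤b | no ¬witness =
    search b λ S S⊆U₁ S-indep →
      s≤s⁻¹ (≤∧≢⇒< (≤b S S⊆U₁ S-indep) (λ ∣S∣≡b → ¬witness (S , S⊆U₁ , S-indep , ∣S∣≡b)))

-- An independent subfamily T ⊆ W of full size rank_G(W) spans the rows W:
-- for u ∈ W ∖ T the family T ∪ {u} is too large to be independent, and in
-- the resulting dependency row u must occur, expressing u through T.
full-rank-spans : ∀ {n} (G : Graph n) {T W : Subset n} {r} → HasRank G W W r →
  T ⊆ W → RowsIndep G T W → ∣ T ∣ ≡ r → Spans (adj G) T W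
full-rank-spans G {T} {W} (_ , W-max) T⊆W T-indep ∣T∣≡r u u∈W with u ∈? T
... | yes u∈T = row-span-basis (adj G) u∈T
... | no u∉T with dependency-or-independent (adj G) (T ∪ ⁅ u ⁆) W
...   | inj₂ T+u-indep =
  contradiction (W-max (T ∪ ⁅ u ⁆) T+u⊆W T+u-indep)
                (<⇒≱ (subst (_< ∣ T ∪ ⁅ u ⁆ ∣) ∣T∣≡r (∣p∣<∣p∪⁅x⁆∣ u∉T)))
  where
  T+u⊆W : T ∪ ⁅ u ⁆ ⊆ W
  T+u⊆W i∈ = [ T⊆W , (λ { refl → u∈W }) ] (∈-∪⁅⁆⁻ T u i∈)
...   | inj₁ (c , c∈ , cA≡0 , i , ci) with c u in cu
...     | false = contradiction (trans (sym ci) (T-indep c (supported-drop T u c∈ cu) cA≡0 i)) λ ()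
...     | true  = (c +ᵥ e u) , supported-remove T u c∈ cu ,
                  vanishes-cong (adj G) (λ i → sym (trans (xor-comm (e u i) _) (xor-cancelʳ (c i) (e u i))))
                                cA≡0

-- Rows inside W that are independent on the columns W ∪ {w} are already
-- independent on W: a combination in ⟨W⟩ vanishing on W is radical, so it
-- also vanishes on the column w.
restrict-independent : ∀ {n} (G : Graph n) {W S T : Subset n} {w w'} →
  Represents G W w w' → T ⊆ W → T ⊆ S → RowsIndep G S (W ∪ ⁅ w ⁆) → RowsIndep G T W
restrict-independent G {W} {w = w} w-rep T⊆W T⊆S S-indep c c∈T cA≡0 =
  S-indep c (supported-mono T⊆S c∈T) cA≡0⁺
  where
  cA≡0⁺ : VanishesOn (adj G) (_∈ W ∪ ⁅ w ⁆) c
  cA≡0⁺ j j∈ with ∈-∪⁅⁆⁻ W w j∈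
  ... | inj₁ j∈W = cA≡0 j j∈W
  ... | inj₂ refl = radical-column G w-rep (supported-mono T⊆W c∈T) cA≡0

-- Adjacency in Γ_W(G) raises the rank: a basis S of W extends to S ∪ {v}.
adjacent⇒rank-jump : ∀ {n} (G : Graph n) {W : Subset n} {v w} → v ∉ W →
  ΓAdj G W v w → RankGreater G (W ∪ ⁅ v ⁆) (W ∪ ⁅ w ⁆) W W
adjacent⇒rank-jump G {W} {v} {w} v∉W (v' , w' , v'⊥ , w'⊥ , v-v' , w-w' , ε≡1)
  with rank-exists G W W | rank-exists G (W ∪ ⁅ v ⁆) (W ∪ ⁅ w ⁆)
... | r , rank-W@((S , S⊆W , S-indep , ∣S∣≡r) , _) | r⁺ , rank-W⁺@(_ , W⁺-max) =
  r⁺ , r , rank-W⁺ , rank-W , (begin-strict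
    r              ≡⟨ sym ∣S∣≡r ⟩
    ∣ S ∣          <⟨ ∣p∣<∣p∪⁅x⁆∣ (v∉W ∘ S⊆W) ⟩
    ∣ S ∪ ⁅ v ⁆ ∣  ≤⟨ W⁺-max (S ∪ ⁅ v ⁆) S+v⊆W+v S+v-indep ⟩
    r⁺             ∎)
  where
  open ≤-Reasoning
  S+v⊆W+v : S ∪ ⁅ v ⁆ ⊆ W ∪ ⁅ v ⁆
  S+v⊆W+v i∈ = [ ∈-∪⁅⁆ˡ v ∘ S⊆W , (λ { refl → ∈-∪⁅⁆ʳ W v }) ] (∈-∪⁅⁆⁻ S v i∈)
  S+v-indep : RowsIndep G (S ∪ ⁅ v ⁆) (W ∪ ⁅ w ⁆)
  S+v-indep = extend-independent G (v'⊥ , v-v') (w'⊥ , w-w') ε≡1 S⊆W S-indep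

-- If ℰ(v',w') = 0, adjoining v and w does not raise the rank: an
-- independent S ⊆ W ∪ {v} either lies in W, or S ∖ {v} is independent in W
-- and cannot have full rank by key lemma B.
no-rank-jump : ∀ {n} (G : Graph n) {W : Subset n} {v w v' w' r} →
  Represents G W v v' → Represents G W w w' → ℰ G v' w' ≡ false → HasRank G W W r →
  ∀ S → S ⊆ W ∪ ⁅ v ⁆ → RowsIndep G S (W ∪ ⁅ w ⁆) → ∣ S ∣ ≤ r
no-rank-jump G {W} {v} v-rep w-rep ε≡0 rank-W@(_ , W-max) S S⊆W+v S-indep with v ∈? S
... | no v∉S = W-max S S⊆W (restrict-independent G w-rep S⊆W (λ i∈S → i∈S) S-indep)
  where
  S⊆W : S ⊆ W
  S⊆W i∈S = [ (λ i∈W → i∈W) , (λ { refl → contradiction i∈S v∉S }) ] (∈-∪⁅⁆⁻ W v (S⊆W+v i∈S))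
... | yes v∈S = begin
  ∣ S ∣      ≡⟨ ∣p∣≡1+∣p-x∣ v∈S ⟩
  suc ∣ T ∣  ≤⟨ ∣T∣<r ⟩
  _          ∎
  where
  open ≤-Reasoning
  T = S - v
  T⊆S : T ⊆ S
  T⊆S = p─q⊆p S ⁅ v ⁆
  T⊆W : T ⊆ W
  T⊆W i∈T = [ (λ i∈W → i∈W) , (λ i≡v → contradiction i≡v (x∈p-y⇒x≢y i∈T)) ]
              (∈-∪⁅⁆⁻ W v (S⊆W+v (T⊆S i∈T)))
  T-indep : RowsIndep G T W
  T-indep = restrict-independent G w-rep T⊆W T⊆S S-indep
  ∣T∣<r : ∣ T ∣ < _
  ∣T∣<r = ≤∧≢⇒< (W-max T T⊆W T-indep) λ ∣T∣≡r →
    dependency-through-v G v-rep w-rep ε≡0 T⊆W (full-rank-spans G rank-W T⊆W T-indep ∣T∣≡r)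
                         T⊆S v∈S (λ v∈T → x∈p-y⇒x≢y v∈T refl) S-indep

rank-jump⇒adjacent : ∀ {n} (G : Graph n) {W : Subset n} → Reducible G W → ∀ {v w} →
  RankGreater G (W ∪ ⁅ v ⁆) (W ∪ ⁅ w ⁆) W W → ΓAdj G W v w
rank-jump⇒adjacent G {W} red {v} {w} (r⁺ , r , ((S , S⊆W+v , S-indep , ∣S∣≡r⁺) , _) , rank-W , r<r⁺)
  with representative G W red v | representative G W red w
... | v' , v-rep@(v'⊥ , v-v') | w' , w-rep@(w'⊥ , w-w') = v' , w' , v'⊥ , w'⊥ , v-v' , w-w' , ε≡1
  where
  ε≡1 : ℰ G v' w' ≡ true
  ε≡1 with ℰ G v' w' in ε
  ... | true  = refl
  ... | false = contradiction (subst (_≤ r) ∣S∣≡r⁺ (no-rank-jump G v-rep w-rep ε rank-W S S⊆W+v S-indep))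
                              (<⇒≱ r<r⁺)

adjacent⇔rank-jump : ∀ {n} (G : Graph n) {W : Subset n} → Reducible G W → ∀ {v w} → v ∉ W →
  ΓAdj G W v w ⇔ RankGreater G (W ∪ ⁅ v ⁆) (W ∪ ⁅ w ⁆) W W
adjacent⇔rank-jump G red v∉W = mk⇔ (adjacent⇒rank-jump G v∉W) (rank-jump⇒adjacent G red)

-- Determinants over F₂.  laplace f g cs = Σ_k f(c_k) · g(cs with c_k deleted)
-- expands a row f against the minors g; Det expands along successive rows.

laplace : ∀ {n} → Vect n → (List (Fin n) → Bool) → List (Fin n) → Bool
laplace f g []       = false
laplace f g (c ∷ cs) = (f c ∧ g cs) xor laplace f (λ ms → g (c ∷ ms)) cs

Det : ∀ {n} → Mat n → List (Fin n) → List (Fin n) → Bool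
Det M []       []      = true
Det M []       (_ ∷ _) = false
Det M (r ∷ rs) cs      = laplace (M r) (Det M rs) cs

laplace-cong : ∀ {n} {f f' : Vect n} {g g' : List (Fin n) → Bool} →
  (∀ c → f c ≡ f' c) → (∀ ms → g ms ≡ g' ms) → ∀ cs → laplace f g cs ≡ laplace f' g' cs
laplace-cong f≗f' g≗g' []       = refl
laplace-cong f≗f' g≗g' (c ∷ cs) =
  cong₂ _xor_ (cong₂ _∧_ (f≗f' c) (g≗g' cs)) (laplace-cong f≗f' (λ ms → g≗g' (c ∷ ms)) cs)

-- The det of Defs, which keeps the passed-over columns in reversed order,
-- agrees with Det.
expand≡laplace : ∀ {n} (G : Graph n) r rs pre cs →
  expand G r rs pre cs ≡ laplace (adj G r) (λ ms → detL G rs (revApp pre ms)) cs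
expand≡laplace G r rs pre []       = refl
expand≡laplace G r rs pre (c ∷ cs) =
  cong ((adj G r c ∧ detL G rs (revApp pre cs)) xor_) (expand≡laplace G r rs (c ∷ pre) cs)

detL≡Det : ∀ {n} (G : Graph n) rs cs → detL G rs cs ≡ Det (adj G) rs cs
detL≡Det G []       []      = refl
detL≡Det G []       (_ ∷ _) = refl
detL≡Det G (r ∷ rs) cs      =
  trans (expand≡laplace G r rs [] cs) (laplace-cong (λ _ → refl) (detL≡Det G rs) cs)

laplace-xorˡ : ∀ {n} (f f' : Vect n) g cs →
  laplace (f +ᵥ f') g cs ≡ laplace f g cs xor laplace f' g cs
laplace-xorˡ f f' g []       = refl
laplace-xorˡ f f' g (c ∷ cs) =
  trans (cong₂ _xor_ (∧-distribʳ-xor (g cs) (f c) (f' c)) (laplace-xorˡ f f' g' cs))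
        (xor-interchange (f c ∧ g cs) (f' c ∧ g cs) (laplace f g' cs) (laplace f' g' cs))
  where g' = λ ms → g (c ∷ ms)

laplace-xorʳ : ∀ {n} (f : Vect n) g g' cs →
  laplace f (λ ms → g ms xor g' ms) cs ≡ laplace f g cs xor laplace f g' cs
laplace-xorʳ f g g' []       = refl
laplace-xorʳ f g g' (c ∷ cs) =
  trans (cong₂ _xor_ (∧-distribˡ-xor (f c) (g cs) (g' cs)) (laplace-xorʳ f h h' cs))
        (xor-interchange (f c ∧ g cs) (f c ∧ g' cs) (laplace f h cs) (laplace f h' cs))
  where
  h  = λ ms → g (c ∷ ms)
  h' = λ ms → g' (c ∷ ms)

laplace-∧ˡ : ∀ {n} b (f : Vect n) g cs → laplace (λ c → b ∧ f c) g cs ≡ b ∧ laplace f g cs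
laplace-∧ˡ b f g []       = sym (∧-zeroʳ b)
laplace-∧ˡ b f g (c ∷ cs) =
  trans (cong₂ _xor_ (∧-assoc b (f c) (g cs)) (laplace-∧ˡ b f _ cs))
        (sym (∧-distribˡ-xor b _ _))

laplace-∧ʳ : ∀ {n} b (f : Vect n) g cs → laplace f (λ ms → b ∧ g ms) cs ≡ b ∧ laplace f g cs
laplace-∧ʳ b f g []       = sym (∧-zeroʳ b)
laplace-∧ʳ b f g (c ∷ cs) =
  trans (cong₂ _xor_ (x∧yz≈y∧xz (f c) b (g cs)) (laplace-∧ʳ b f _ cs))
        (sym (∧-distribˡ-xor b _ _))
  where
  x∧yz≈y∧xz : ∀ x y z → x ∧ (y ∧ z) ≡ y ∧ (x ∧ z)
  x∧yz≈y∧xz x y z = trans (sym (∧-assoc x y z)) (trans (cong (_∧ z) (∧-comm x y)) (∧-assoc y x z))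

laplace-zeroʳ : ∀ {n} (f : Vect n) g → (∀ ms → g ms ≡ false) → ∀ cs → laplace f g cs ≡ false
laplace-zeroʳ f g g≡0 []       = refl
laplace-zeroʳ f g g≡0 (c ∷ cs) =
  cong₂ _xor_ (trans (cong (f c ∧_) (g≡0 cs)) (∧-zeroʳ (f c)))
              (laplace-zeroʳ f _ (λ ms → g≡0 (c ∷ ms)) cs)

-- Expanding twice along the same row gives 0 (two equal rows).
laplace-twice : ∀ {n} (f : Vect n) g cs → laplace f (laplace f g) cs ≡ false
laplace-twice f g []       = refl
laplace-twice f g (c ∷ cs) = begin
  x xor laplace f (λ ms → (f c ∧ g ms) xor laplace f g' ms) cs
    ≡⟨ cong (x xor_) (laplace-xorʳ f (λ ms → f c ∧ g ms) (laplace f g') cs) ⟩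
  x xor (laplace f (λ ms → f c ∧ g ms) cs xor laplace f (laplace f g') cs)
    ≡⟨ cong (x xor_) (cong₂ _xor_ (laplace-∧ʳ (f c) f g cs) (laplace-twice f g' cs)) ⟩
  x xor (x xor false)
    ≡⟨ cong (x xor_) (xor-identityʳ x) ⟩
  x xor x
    ≡⟨ xor-same x ⟩
  false ∎
  where
  open ≡-Reasoning
  g' = λ ms → g (c ∷ ms)
  x  = f c ∧ laplace f g cs

xor≡false⇒≡ : ∀ {a b} → a xor b ≡ false → a ≡ b
xor≡false⇒≡ {a} {b} a⊕b≡0 = trans (sym (xor-cancelʳ a b)) (cong (_xor b) a⊕b≡0)

-- Expansions along two rows commute (polarise laplace-twice at f + f').
laplace-swap : ∀ {n} (f f' : Vect n) g cs →
  laplace f (laplace f' g) cs ≡ laplace f' (laplace f g) cs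
laplace-swap f f' g cs = xor≡false⇒≡ (begin
  X xor Y
    ≡⟨ sym (cong₂ _xor_ (cong (_xor X) (laplace-twice f g cs))
                        (trans (cong (Y xor_) (laplace-twice f' g cs)) (xor-identityʳ Y))) ⟩
  (laplace f (laplace f g) cs xor X) xor (Y xor laplace f' (laplace f' g) cs)
    ≡⟨ sym (cong₂ _xor_ (laplace-xorʳ f (laplace f g) (laplace f' g) cs)
                        (laplace-xorʳ f' (laplace f g) (laplace f' g) cs)) ⟩
  laplace f (λ ms → laplace f g ms xor laplace f' g ms) cs xor
  laplace f' (λ ms → laplace f g ms xor laplace f' g ms) cs
    ≡⟨ sym (laplace-xorˡ f f' _ cs) ⟩
  laplace (f +ᵥ f') (λ ms → laplace f g ms xor laplace f' g ms) cs
    ≡⟨ laplace-cong (λ _ → refl) (λ ms → sym (laplace-xorˡ f f' g ms)) cs ⟩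
  laplace (f +ᵥ f') (laplace (f +ᵥ f') g) cs
    ≡⟨ laplace-twice (f +ᵥ f') g cs ⟩
  false ∎)
  where
  open ≡-Reasoning
  X = laplace f (laplace f' g) cs
  Y = laplace f' (laplace f g) cs

laplace-zero-column : ∀ {n} (f : Vect n) g c → f c ≡ false →
  (∀ ms → c ∈ˡ ms → g ms ≡ false) → ∀ cs → c ∈ˡ cs → laplace f g cs ≡ false
laplace-zero-column f g c fc≡0 g≡0 (c ∷ cs) (Any.here refl) =
  cong₂ _xor_ (cong (_∧ g cs) fc≡0) (laplace-zeroʳ f _ (λ ms → g≡0 (c ∷ ms) (Any.here refl)) cs)
laplace-zero-column f g c fc≡0 g≡0 (c' ∷ cs) (Any.there c∈cs) =
  cong₂ _xor_ (trans (cong (f c' ∧_) (g≡0 cs c∈cs)) (∧-zeroʳ (f c')))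
              (laplace-zero-column f _ c fc≡0 (λ ms c∈ms → g≡0 (c' ∷ ms) (Any.there c∈ms)) cs c∈cs)

Det-zero-column : ∀ {n} (M : Mat n) {c} rs → (∀ {k} → k ∈ˡ rs → M k c ≡ false) →
  ∀ cs → c ∈ˡ cs → Det M rs cs ≡ false
Det-zero-column M []       col≡0 (_ ∷ _) _    = refl
Det-zero-column M (r ∷ rs) col≡0 cs      c∈cs =
  laplace-zero-column (M r) (Det M rs) _ (col≡0 (Any.here refl))
    (Det-zero-column M rs (col≡0 ∘ Any.there)) cs c∈cs

Det-repeated-row : ∀ {n} (M : Mat n) {p} rs → p ∈ˡ rs → ∀ cs → Det M (p ∷ rs) cs ≡ false
Det-repeated-row M (p ∷ rs) (Any.here refl) cs = laplace-twice (M p) (Det M rs) cs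
Det-repeated-row M {p} (r ∷ rs) (Any.there p∈rs) cs =
  trans (laplace-swap (M p) (M r) (Det M rs) cs)
        (laplace-zeroʳ (M r) _ (Det-repeated-row M rs p∈rs) cs)

addRow : ∀ {n} → Mat n → Vect n → Fin n → Mat n
addRow M a p k j = M k j xor (a k ∧ M p j)

laplace-addRow : ∀ {n} (f h : Vect n) b g cs →
  laplace (λ j → f j xor (b ∧ h j)) g cs ≡ laplace f g cs xor (b ∧ laplace h g cs)
laplace-addRow f h b g cs =
  trans (laplace-xorˡ f (λ j → b ∧ h j) g cs) (cong (laplace f g cs xor_) (laplace-∧ˡ b h g cs))

laplace-addRow-invariant : ∀ {n} (M : Mat n) a p ss cs →
  laplace (M p) (Det (addRow M a p) ss) cs ≡ laplace (M p) (Det M ss) cs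
laplace-addRow-invariant M a p [] cs =
  laplace-cong (λ _ → refl) (λ { [] → refl ; (_ ∷ _) → refl }) cs
laplace-addRow-invariant M a p (s ∷ ss) cs = begin
  laplace (M p) (laplace (M' s) (Det M' ss)) cs
    ≡⟨ laplace-swap (M p) (M' s) (Det M' ss) cs ⟩
  laplace (M' s) (laplace (M p) (Det M' ss)) cs
    ≡⟨ laplace-cong (λ _ → refl) (laplace-addRow-invariant M a p ss) cs ⟩
  laplace (M' s) (laplace (M p) (Det M ss)) cs
    ≡⟨ laplace-addRow (M s) (M p) (a s) _ cs ⟩
  laplace (M s) (laplace (M p) (Det M ss)) cs xor (a s ∧ laplace (M p) (laplace (M p) (Det M ss)) cs)
    ≡⟨ xor-∧-zeroʳ _ (a s) (laplace-twice (M p) (Det M ss) cs) ⟩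
  laplace (M s) (laplace (M p) (Det M ss)) cs
    ≡⟨ laplace-swap (M s) (M p) (Det M ss) cs ⟩
  laplace (M p) (laplace (M s) (Det M ss)) cs ∎
  where
  open ≡-Reasoning
  M' = addRow M a p

-- Adding multiples of a row p ∈ rs to the other rows does not change Det
-- (multilinearity, and Det-repeated-row for the added copies of row p).
Det-addRow : ∀ {n} (M : Mat n) a {p} rs → p ∈ˡ rs → a p ≡ false →
  ∀ cs → Det (addRow M a p) rs cs ≡ Det M rs cs
Det-addRow M a {p} (p ∷ rs) (Any.here refl) ap≡0 cs =
  trans (laplace-cong (λ j → xor-∧-zeroˡ (M p j) (M p j) ap≡0) (λ _ → refl) cs)
        (laplace-addRow-invariant M a p rs cs)
Det-addRow M a {p} (r ∷ rs) (Any.there p∈rs) ap≡0 cs = begin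
  laplace (addRow M a p r) (Det (addRow M a p) rs) cs
    ≡⟨ laplace-cong (λ _ → refl) (Det-addRow M a rs p∈rs ap≡0) cs ⟩
  laplace (addRow M a p r) (Det M rs) cs
    ≡⟨ laplace-addRow (M r) (M p) (a r) (Det M rs) cs ⟩
  laplace (M r) (Det M rs) cs xor (a r ∧ Det M (p ∷ rs) cs)
    ≡⟨ xor-∧-zeroʳ _ (a r) (Det-repeated-row M rs p∈rs cs) ⟩
  laplace (M r) (Det M rs) cs ∎
  where open ≡-Reasoning

independent-cong : ∀ {n} {M M' : Mat n} {P Q : Fin n → Set} → (∀ k j → M k j ≡ M' k j) →
  Independent M P Q → Independent M' P Q
independent-cong M≗M' M-indep c c∈P cM'≡0 =
  M-indep c c∈P (λ j j∈Q → trans (sumF-cong (λ i → cong (c i ∧_) (M≗M' i j))) (cM'≡0 j j∈Q))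

independent-mono : ∀ {n} {M : Mat n} {P P' Q Q' : Fin n → Set} →
  (∀ {i} → P' i → P i) → (∀ {j} → Q j → Q' j) → Independent M P Q → Independent M P' Q'
independent-mono P'⊆P Q⊆Q' M-indep c c∈P' cM≡0 =
  M-indep c (supported-mono P'⊆P c∈P') (λ j j∈Q → cM≡0 j (Q⊆Q' j∈Q))

dot : ∀ {n} → Vect n → Vect n → Bool
dot x y = sumF (λ i → x i ∧ y i)

lincomb-addRow : ∀ {n} (M : Mat n) a p x j →
  lincomb (addRow M a p) x j ≡ lincomb M (x +ᵥ (λ i → dot x a ∧ e p i)) j
lincomb-addRow M a p x j = begin
  sumF (λ i → x i ∧ (M i j xor (a i ∧ M p j)))
    ≡⟨ sumF-cong (λ i → ∧-distribˡ-xor (x i) (M i j) (a i ∧ M p j)) ⟩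
  sumF (λ i → (x i ∧ M i j) xor (x i ∧ (a i ∧ M p j)))
    ≡⟨ sumF-xor (λ i → x i ∧ M i j) (λ i → x i ∧ (a i ∧ M p j)) ⟩
  lincomb M x j xor sumF (λ i → x i ∧ (a i ∧ M p j))
    ≡⟨ cong (lincomb M x j xor_) (trans (sumF-cong (λ i → sym (∧-assoc (x i) (a i) (M p j))))
                                        (sumF-∧ʳ (M p j) (λ i → x i ∧ a i))) ⟩
  lincomb M x j xor (⟨x,a⟩ ∧ M p j)
    ≡⟨ cong (lincomb M x j xor_) (sym shifted) ⟩
  lincomb M x j xor lincomb M (λ i → ⟨x,a⟩ ∧ e p i) j
    ≡⟨ sym (lincomb-xor M x _ j) ⟩
  lincomb M (x +ᵥ (λ i → ⟨x,a⟩ ∧ e p i)) j ∎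
  where
  open ≡-Reasoning
  ⟨x,a⟩ = dot x a
  shifted : lincomb M (λ i → ⟨x,a⟩ ∧ e p i) j ≡ ⟨x,a⟩ ∧ M p j
  shifted =
    trans (sumF-cong (λ i → trans (∧-assoc ⟨x,a⟩ (e p i) (M i j)) (cong (⟨x,a⟩ ∧_) (∧-comm (e p i) (M i j)))))
          (trans (sumF-∧ˡ ⟨x,a⟩ (λ i → M i j ∧ e p i)) (cong (⟨x,a⟩ ∧_) (sumF-e (λ i → M i j) p)))

-- If x is a dependency for addRow M a p, then x + ⟨x,a⟩ e_p is one for M;
-- as a_p = 0, it vanishes only if x does.
addRow-independent : ∀ {n} (M : Mat n) a {p} {P Q : Fin n → Set} → P p → a p ≡ false →
  Independent M P Q → Independent (addRow M a p) P Q
addRow-independent M a {p} {P} p∈P ap≡0 M-indep x x∈P xM'≡0 i =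
  trans (sym (xor-cancelʳ (x i) (⟨x,a⟩ ∧ e p i))) (cong₂ _xor_ (x'≡0 i) (cong (_∧ e p i) ⟨x,a⟩≡0))
  where
  ⟨x,a⟩ = dot x a
  x' = x +ᵥ (λ i → ⟨x,a⟩ ∧ e p i)
  x'≡0 : ∀ i → x' i ≡ false
  x'≡0 = M-indep x'
    (supported-xor x∈P λ i ¬Pi →
       trans (cong (⟨x,a⟩ ∧_) (e-other p i (λ { refl → ¬Pi p∈P }))) (∧-zeroʳ ⟨x,a⟩))
    (λ j j∈Q → trans (sym (lincomb-addRow M a p x j)) (xM'≡0 j j∈Q))
  ⟨x,a⟩≡0 : ⟨x,a⟩ ≡ false
  ⟨x,a⟩≡0 = sumF-zero _ term≡0
    where
    term≡0 : ∀ i → x i ∧ a i ≡ false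
    term≡0 i with i ≟ p
    ... | yes refl = trans (cong (x p ∧_) ap≡0) (∧-zeroʳ (x p))
    ... | no i≢p   = cong (_∧ a i) (trans (sym (xor-∧-zeroʳ (x i) ⟨x,a⟩ (e-other p i i≢p))) (x'≡0 i))

addRow-involutive : ∀ {n} (M : Mat n) a p → a p ≡ false → ∀ k j → addRow (addRow M a p) a p k j ≡ M k j
addRow-involutive M a p ap≡0 k j =
  trans (cong (λ t → (M k j xor (a k ∧ M p j)) xor (a k ∧ t)) (xor-∧-zeroˡ (M p j) (M p j) ap≡0))
        (xor-cancelʳ (M k j) (a k ∧ M p j))

_≈[_]_ : ∀ {n} → Mat n → List (Fin n) → Mat n → Set
M ≈[ rs ] M' = (∀ cs → Det M' rs cs ≡ Det M rs cs)
             × (∀ cs → Independent M (_∈ˡ rs) (_∈ˡ cs) ⇔ Independent M' (_∈ˡ rs) (_∈ˡ cs))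

≈-refl : ∀ {n} {M : Mat n} {rs} → M ≈[ rs ] M
≈-refl = (λ _ → refl) , (λ _ → ⇔-id _)

≈-trans : ∀ {n} {M M' M'' : Mat n} {rs} → M ≈[ rs ] M' → M' ≈[ rs ] M'' → M ≈[ rs ] M''
≈-trans (Det≡ , indep⇔) (Det≡' , indep⇔') =
  (λ cs → trans (Det≡' cs) (Det≡ cs)) , (λ cs → indep⇔' cs ⇔-∘ indep⇔ cs)

addRow-≈ : ∀ {n} (M : Mat n) a {p rs} → p ∈ˡ rs → a p ≡ false → M ≈[ rs ] addRow M a p
addRow-≈ M a {p} {rs} p∈rs ap≡0 =
  Det-addRow M a rs p∈rs ap≡0 ,
  λ cs → mk⇔ (addRow-independent M a p∈rs ap≡0)
             (independent-cong (addRow-involutive M a p ap≡0) ∘ addRow-independent (addRow M a p) a p∈rs ap≡0)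

pivot? : ∀ {n} (M : Mat n) c rs →
  (∃ λ p → p ∈ˡ rs × M p c ≡ true) ⊎ (∀ {k} → k ∈ˡ rs → M k c ≡ false)
pivot? M c rs with Any.any? (λ k → M k c Bool.≟ true) rs
... | yes found = inj₁ (find found)
... | no none   = inj₂ (λ k∈rs → Bool.¬-not (All.lookup (¬Any⇒All¬ rs none) k∈rs))

make-pivot : ∀ {n} (M : Mat n) {r rs} c → r ∉ˡ rs → ∀ {p} → p ∈ˡ (r ∷ rs) → M p c ≡ true →
  Σ (Mat n) λ M₁ → M ≈[ r ∷ rs ] M₁ × M₁ r c ≡ true
make-pivot M {r} c r∉rs p∈ Mpc with M r c in Mrc
... | true = M , ≈-refl , Mrc
make-pivot M c r∉rs (Any.here refl) Mpc | false = contradiction (trans (sym Mpc) Mrc) λ ()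
make-pivot M {r} c r∉rs {p} (Any.there p∈rs) Mpc | false =
  addRow M (e r) p , addRow-≈ M (e r) (Any.there p∈rs) (e-other r p p≢r) ,
  cong₂ _xor_ Mrc (cong₂ _∧_ (e-self r) Mpc)
  where
  p≢r : p ≢ r
  p≢r refl = r∉rs p∈rs

clear-column : ∀ {n} (M : Mat n) {r rs} c → r ∈ˡ rs → M r c ≡ true →
  Σ (Mat n) λ M₂ → M ≈[ rs ] M₂ × (∀ k → M₂ k c ≡ e r k)
clear-column {n} M {r} c r∈rs Mrc = addRow M a r , addRow-≈ M a r∈rs ar≡0 , unit
  where
  a : Vect n
  a k = M k c ∧ not (e r k)
  ar≡0 : a r ≡ false
  ar≡0 = trans (cong (λ b → M r c ∧ not b) (e-self r)) (∧-zeroʳ (M r c))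
  -- (the case split on k ≟ r evaluates e r k in the goal)
  unit : ∀ k → M k c xor (a k ∧ M r c) ≡ e r k
  unit k with k ≟ r
  ... | yes refl = trans (xor-∧-zeroˡ (M r c) (M r c) (∧-zeroʳ (M r c))) Mrc
  ... | no k≢r   = begin
    M k c xor ((M k c ∧ true) ∧ M r c)  ≡⟨ cong (λ b → M k c xor ((M k c ∧ true) ∧ b)) Mrc ⟩
    M k c xor ((M k c ∧ true) ∧ true)   ≡⟨ cong (M k c xor_) (trans (∧-identityʳ _) (∧-identityʳ _)) ⟩
    M k c xor M k c                     ≡⟨ xor-same (M k c) ⟩
    false                               ∎
    where open ≡-Reasoning

eliminate : ∀ {n} (M : Mat n) {r rs} c → r ∉ˡ rs → (∃ λ p → p ∈ˡ (r ∷ rs) × M p c ≡ true) →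
  Σ (Mat n) λ M₂ → M ≈[ r ∷ rs ] M₂ × (∀ k → M₂ k c ≡ e r k)
eliminate M c r∉rs (p , p∈ , Mpc) =
  let M₁ , M≈M₁ , M₁rc = make-pivot M c r∉rs p∈ Mpc
      M₂ , M₁≈M₂ , unit = clear-column M₁ c (Any.here refl) M₁rc
  in  M₂ , ≈-trans M≈M₁ M₁≈M₂ , unit

lincomb-unit-column : ∀ {n} (M : Mat n) {c r} → (∀ k → M k c ≡ e r k) → ∀ x → lincomb M x c ≡ x r
lincomb-unit-column M {c} {r} unit x = trans (sumF-cong (λ i → cong (x i ∧_) (unit i))) (sumF-e x r)

Det-unit-column : ∀ {n} (M : Mat n) {c r rs} → (∀ k → M k c ≡ e r k) → r ∉ˡ rs →
  ∀ cs → Det M (r ∷ rs) (c ∷ cs) ≡ Det M rs cs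
Det-unit-column M {c} {r} {rs} unit r∉rs cs =
  trans (cong₂ _xor_ (cong (_∧ Det M rs cs) (trans (unit r) (e-self r)))
                     (laplace-zeroʳ (M r) _ (λ ms → Det-zero-column M rs col≡0 (c ∷ ms) (Any.here refl)) cs))
        (xor-identityʳ (Det M rs cs))
  where
  col≡0 : ∀ {k} → k ∈ˡ rs → M k c ≡ false
  col≡0 {k} k∈rs = trans (unit k) (e-other r k (λ { refl → r∉rs k∈rs }))

independent-unit-column : ∀ {n} (M : Mat n) {c r rs cs} → (∀ k → M k c ≡ e r k) → r ∉ˡ rs →
  Independent M (_∈ˡ r ∷ rs) (_∈ˡ c ∷ cs) ⇔ Independent M (_∈ˡ rs) (_∈ˡ cs)
independent-unit-column M {c} {r} {rs} {cs} unit r∉rs = mk⇔ to from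
  where
  to : Independent M (_∈ˡ r ∷ rs) (_∈ˡ c ∷ cs) → Independent M (_∈ˡ rs) (_∈ˡ cs)
  to indep x x∈rs xM≡0 = indep x (supported-mono Any.there x∈rs) λ
    { j (Any.here refl) → trans (lincomb-unit-column M unit x) (x∈rs r r∉rs)
    ; j (Any.there j∈cs) → xM≡0 j j∈cs }
  from : Independent M (_∈ˡ rs) (_∈ˡ cs) → Independent M (_∈ˡ r ∷ rs) (_∈ˡ c ∷ cs)
  from indep x x∈ xM≡0 = indep x x∈rs (λ j j∈cs → xM≡0 j (Any.there j∈cs))
    where
    x∈rs : SupportedIn (_∈ˡ rs) x
    x∈rs i i∉rs with i ≟ r
    ... | yes refl = trans (sym (lincomb-unit-column M unit x)) (xM≡0 c (Any.here refl))
    ... | no i≢r   = x∈ i λ { (Any.here i≡r) → i≢r i≡r ; (Any.there i∈rs) → i∉rs i∈rs }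

independent-zero-column : ∀ {n} (M : Mat n) {c rs cs} → (∀ {k} → k ∈ˡ rs → M k c ≡ false) →
  Independent M (_∈ˡ rs) (_∈ˡ c ∷ cs) → Independent M (_∈ˡ rs) (_∈ˡ cs)
independent-zero-column M {c} {rs} col≡0 indep x x∈rs xM≡0 = indep x x∈rs λ
  { j (Any.here refl) → sumF-zero _ term≡0
  ; j (Any.there j∈cs) → xM≡0 j j∈cs }
  where
  term≡0 : ∀ i → x i ∧ M i c ≡ false
  term≡0 i with Any.any? (i ≟_) rs
  ... | yes i∈rs = trans (cong (x i ∧_) (col≡0 i∈rs)) (∧-zeroʳ (x i))
  ... | no i∉rs  = cong (_∧ M i c) (x∈rs i i∉rs)

head-fresh : ∀ {n} {r : Fin n} {rs} → Unique (r ∷ rs) → r ∉ˡ rs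
head-fresh (r≢rs ∷ _) = All¬⇒¬Any r≢rs

independent⇒length≤ : ∀ {n} (cs rs : List (Fin n)) (M : Mat n) → Unique rs →
  Independent M (_∈ˡ rs) (_∈ˡ cs) → length rs ≤ length cs
independent⇒length≤ cs       []       M _ _ = z≤n
independent⇒length≤ []       (r ∷ rs) M _ indep =
  contradiction (trans (sym (e-self r)) (indep (e r) er∈ (λ _ ()) r)) λ ()
  where
  er∈ : SupportedIn (_∈ˡ r ∷ rs) (e r)
  er∈ i i∉ = e-other r i (λ { refl → i∉ (Any.here refl) })
independent⇒length≤ (c ∷ cs) (r ∷ rs) M uniq@(_ ∷ uniq-rs) indep with pivot? M c (r ∷ rs)
... | inj₂ col≡0 =
  m≤n⇒m≤1+n (independent⇒length≤ cs (r ∷ rs) M uniq (independent-zero-column M col≡0 indep))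
... | inj₁ pivot with eliminate M c (head-fresh uniq) pivot
...   | M₂ , (_ , indep⇔) , unit =
  s≤s (independent⇒length≤ cs rs M₂ uniq-rs
         (Equivalence.to (independent-unit-column M₂ unit (head-fresh uniq))
                         (Equivalence.to (indep⇔ (c ∷ cs)) indep)))

Det≡true⇔independent : ∀ {n} (rs cs : List (Fin n)) (M : Mat n) → Unique rs →
  length rs ≡ length cs → (Det M rs cs ≡ true) ⇔ Independent M (_∈ˡ rs) (_∈ˡ cs)
Det≡true⇔independent []       []       M _ _ = mk⇔ (λ _ x x∈[] _ i → x∈[] i λ ()) (λ _ → refl)
Det≡true⇔independent (r ∷ rs) (c ∷ cs) M uniq@(_ ∷ uniq-rs) ∣rs∣≡∣cs∣ with pivot? M c (r ∷ rs)
... | inj₂ col≡0 = mk⇔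
  (λ Det≡1 → contradiction (trans (sym Det≡1) (Det-zero-column M (r ∷ rs) col≡0 (c ∷ cs) (Any.here refl)))
                           λ ())
  (λ indep → contradiction
     (subst (_≤ length cs) ∣rs∣≡∣cs∣
            (independent⇒length≤ cs (r ∷ rs) M uniq (independent-zero-column M col≡0 indep)))
     (<-irrefl refl))
... | inj₁ pivot with eliminate M c (head-fresh uniq) pivot
...   | M₂ , (Det≡ , indep⇔) , unit =
  -- Det M = 1  ⇔  Det M₂ (rows rs, columns cs) = 1  ⇔  (induction)
  -- independence for M₂ on rs, cs  ⇔  ... on r ∷ rs, c ∷ cs  ⇔  ... for M
  ⇔-sym (indep⇔ (c ∷ cs)) ⇔-∘ (⇔-sym (independent-unit-column M₂ unit (head-fresh uniq))
    ⇔-∘ (Det≡true⇔independent rs cs M₂ uniq-rs (suc-injective ∣rs∣≡∣cs∣) ⇔-∘ same-Det))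
  where
  Det-split : Det M (r ∷ rs) (c ∷ cs) ≡ Det M₂ rs cs
  Det-split = trans (sym (Det≡ (c ∷ cs))) (Det-unit-column M₂ unit (head-fresh uniq) cs)
  same-Det : (Det M (r ∷ rs) (c ∷ cs) ≡ true) ⇔ (Det M₂ rs cs ≡ true)
  same-Det = mk⇔ (trans (sym Det-split)) (trans Det-split)

elems-∈⁻ : ∀ {n} (U : Subset n) {i} → i ∈ˡ elems U → i ∈ U
elems-∈⁻ (inside  ∷ U) (Any.here refl) = here
elems-∈⁻ (inside  ∷ U) (Any.there i∈)  with ∈-map⁻ suc i∈
... | j , j∈ , refl = there (elems-∈⁻ U j∈)
elems-∈⁻ (outside ∷ U) i∈              with ∈-map⁻ suc i∈
... | j , j∈ , refl = there (elems-∈⁻ U j∈)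

elems-∈⁺ : ∀ {n} (U : Subset n) {i} → i ∈ U → i ∈ˡ elems U
elems-∈⁺ (inside  ∷ U) here        = Any.here refl
elems-∈⁺ (inside  ∷ U) (there i∈U) = Any.there (∈-map⁺ suc (elems-∈⁺ U i∈U))
elems-∈⁺ (outside ∷ U) (there i∈U) = ∈-map⁺ suc (elems-∈⁺ U i∈U)

elems-unique : ∀ {n} (U : Subset n) → Unique (elems U)
elems-unique []            = []
elems-unique (inside  ∷ U) =
  AllP.map⁺ (All.universal (λ _ ()) (elems U)) ∷ map⁺ Fin.suc-injective (elems-unique U)
elems-unique (outside ∷ U) = map⁺ Fin.suc-injective (elems-unique U)

elems-length : ∀ {n} (U : Subset n) → length (elems U) ≡ ∣ U ∣
elems-length []            = refl
elems-length (inside  ∷ U) = cong suc (trans (length-map suc (elems U)) (elems-length U))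
elems-length (outside ∷ U) = trans (length-map suc (elems U)) (elems-length U)

det≡true⇔rows-independent : ∀ {n} (G : Graph n) U₁ U₂ → ∣ U₁ ∣ ≡ ∣ U₂ ∣ →
  (det G U₁ U₂ ≡ true) ⇔ RowsIndep G U₁ U₂
det≡true⇔rows-independent G U₁ U₂ ∣U₁∣≡∣U₂∣ =
  mk⇔ (independent-mono (elems-∈⁺ U₁) (elems-∈⁻ U₂)) (independent-mono (elems-∈⁻ U₁) (elems-∈⁺ U₂))
  ⇔-∘ (Det≡true⇔independent (elems U₁) (elems U₂) (adj G) (elems-unique U₁) same-length
  ⇔-∘ mk⇔ (trans (sym det≡Det)) (trans det≡Det))
  where
  det≡Det : det G U₁ U₂ ≡ Det (adj G) (elems U₁) (elems U₂)
  det≡Det = detL≡Det G (elems U₁) (elems U₂)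
  same-length : length (elems U₁) ≡ length (elems U₂)
  same-length = trans (elems-length U₁) (trans ∣U₁∣≡∣U₂∣ (sym (elems-length U₂)))

nonsingular⇒independent : ∀ {n} (G : Graph n) {W : Subset n} → Nonsingular G W → RowsIndep G W W
nonsingular⇒independent G ((S , S⊆W , S-indep , ∣S∣≡∣W∣) , _) =
  independent-mono (⊆∧∣≡∣⇒⊇ S⊆W ∣S∣≡∣W∣) (λ j∈W → j∈W) S-indep

-- For nonsingular W, adjacency in Γ_W(G) means that W ∪ {v} is independent on
-- W ∪ {w} (key lemmas A and B with S = T = W), i.e. that the square submatrix
-- A_{W∪{v},W∪{w}} is nonsingular.
adjacent⇔det : ∀ {n} (G : Graph n) {W : Subset n} → Reducible G W → ∀ {v w} → v ∉ W → w ∉ W →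
  Nonsingular G W → ΓAdj G W v w ⇔ (det G (W ∪ ⁅ v ⁆) (W ∪ ⁅ w ⁆) ≡ true)
adjacent⇔det G {W} red {v} {w} v∉W w∉W W-nonsingular =
  ⇔-sym (det≡true⇔rows-independent G _ _ same-size) ⇔-∘ mk⇔ to from
  where
  same-size : ∣ W ∪ ⁅ v ⁆ ∣ ≡ ∣ W ∪ ⁅ w ⁆ ∣
  same-size = trans (∣p∪⁅x⁆∣≡1+∣p∣ v∉W) (sym (∣p∪⁅x⁆∣≡1+∣p∣ w∉W))
  to : ΓAdj G W v w → RowsIndep G (W ∪ ⁅ v ⁆) (W ∪ ⁅ w ⁆)
  to (v' , w' , v'⊥ , w'⊥ , v-v' , w-w' , ε≡1) =
    extend-independent G (v'⊥ , v-v') (w'⊥ , w-w') ε≡1 ⊆-refl (nonsingular⇒independent G W-nonsingular)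
  from : RowsIndep G (W ∪ ⁅ v ⁆) (W ∪ ⁅ w ⁆) → ΓAdj G W v w
  from indep with representative G W red v | representative G W red w
  ... | v' , v-rep@(v'⊥ , v-v') | w' , w-rep@(w'⊥ , w-w') = v' , w' , v'⊥ , w'⊥ , v-v' , w-w' , ε≡1
    where
    ε≡1 : ℰ G v' w' ≡ true
    ε≡1 with ℰ G v' w' in ε
    ... | true  = refl
    ... | false = contradiction indep
      (dependency-through-v G v-rep w-rep ε ⊆-refl (λ u u∈W → row-span-basis (adj G) u∈W)
                            (∈-∪⁅⁆ˡ v) (∈-∪⁅⁆ʳ W v) v∉W)

mainTheorem7 : ∀ {n : ℕ} (G : Graph n) (W : Subset n) → Reducible G W →
    (v w : Fin n) → v ∉ W → w ∉ W →
    (ΓAdj G W v w ⇔ RankGreater G (W ∪ ⁅ v ⁆) (W ∪ ⁅ w ⁆) W W)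
    × (Nonsingular G W → (ΓAdj G W v w ⇔ (det G (W ∪ ⁅ v ⁆) (W ∪ ⁅ w ⁆) ≡ true)))
mainTheorem7 G W red v w v∉W w∉W = adjacent⇔rank-jump G red v∉W , adjacent⇔det G red v∉W w∉W
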